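{- Let $d,n\ge1$ and let $\bm\mu=(\mu_1,\dots,\mu_d)$ be a $d$-tuple of probability distributions on $[n]$. Let $\mathcal J_{\bm\mu}$ be the set of arrays $J:[n]^d\to\mathbb R_{\ge0}$ such that for every $i\in[d]$ and $k\in[n]$, $$\sum_{\mathbf m\in[n]^d,\ m_i=k} J(\mathbf m)=\mu_i(k).$$ Let $C(\mathbf m)=\min_{i\in[d]}\sum_{j\ne i}|m_i-m_j|$ for $\mathbf m\in[n]^d$. Then the infimum $$\inf_{J\in\mathcal J_{\bm\mu}}\sum_{\mathbf m\in[n]^d}C(\mathbf m)J(\mathbf m)$$ is attained by some $J\in\mathcal J_{\bm\mu}$ whose support $\{\mathbf m: J(\mathbf m)\neq 0\}$ is a chain in $[n]^d$, i.e. any two elements of the support are comparable in the product (componentwise) order.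
   Context: $[n]=\{1,\dots,n\}$. A probability distribution on $[n]$ is a vector $\mu\in\mathbb R_{\ge0}^n$ with components summing to $1$; $\mu(k)$ is its $k$-th component. The minimum value is called the generalized earth mover's distance $\mathrm{EMD}_d(\bm\mu)$. -}

module Defs where

open import Level using (Level; _⊔_) renaming (suc to lsuc)
open import Data.Nat as ℕ using (ℕ; zero; suc; ∣_-_∣)
open import Data.Fin as Fin using (Fin; toℕ)
open import Data.List using (List; []; _∷_; map; concatMap; foldr; filter)
open import Data.List.Base using (allFin)
open import Data.Product using (Σ; ∃; _×_)
open import Data.Sum using (_⊎_)
open import Relation.Nullary using (¬_)
open import Relation.Binary.PropositionalEquality using (_≡_)
open import Relation.Binary.Structures using (IsTotalOrder)
open import Algebra.Bundles using (CommutativeRing)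

-- Ordered fields (the standard library has no real numbers; we state the
-- result over an arbitrary ordered field, of which ℝ is an instance).

record OrderedField (c ℓ₁ ℓ₂ : Level) : Set (lsuc (c ⊔ ℓ₁ ⊔ ℓ₂)) where
  field
    commutativeRing : CommutativeRing c ℓ₁
  open CommutativeRing commutativeRing public
  field
    _≤_          : Carrier → Carrier → Set ℓ₂
    isTotalOrder : IsTotalOrder _≈_ _≤_
    +-mono-≤     : ∀ {x y} z → x ≤ y → (x + z) ≤ (y + z)
    *-nonneg     : ∀ {x y} → 0# ≤ x → 0# ≤ y → 0# ≤ (x * y)
    0≉1          : ¬ (0# ≈ 1#)
    inverse      : ∀ x → ¬ (x ≈ 0#) → ∃ λ y → (x * y) ≈ 1#

-- [n]^d is represented as Fin d → Fin n (coordinates 0-based).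
Tuple : ℕ → ℕ → Set
Tuple d n = Fin d → Fin n

consT : ∀ {d n} → Fin n → Tuple d n → Tuple (suc d) n
consT k t Fin.zero    = k
consT k t (Fin.suc i) = t i

allTuples : (d n : ℕ) → List (Tuple d n)
allTuples zero    n = (λ ()) ∷ []
allTuples (suc d) n = concatMap (λ k → map (consT k) (allTuples d n)) (allFin n)

sumℕ : List ℕ → ℕ
sumℕ = foldr ℕ._+_ 0

-- minimum of a list of naturals (only used on nonempty lists)
minList : List ℕ → ℕ
minList []       = 0
minList (x ∷ []) = x
minList (x ∷ y ∷ xs) = x ℕ.⊓ minList (y ∷ xs)

-- C(m) = min_i Σ_{j ≠ i} |m_i - m_j|   (the j = i term is 0 anyway)
cost : ∀ {d n} → Tuple d n → ℕ
cost {d} m = minList (map (λ i → sumℕ (map (λ j → ∣ toℕ (m i) - toℕ (m j) ∣) (allFin d))) (allFin d))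

_≤ₜ_ : ∀ {d n} → Tuple d n → Tuple d n → Set
m ≤ₜ m' = ∀ i → m i Fin.≤ m' i

module _ {c ℓ₁ ℓ₂} (F : OrderedField c ℓ₁ ℓ₂) where
  open OrderedField F

  sumF : List Carrier → Carrier
  sumF = foldr _+_ 0#

  ℕ→F : ℕ → Carrier
  ℕ→F zero    = 0#
  ℕ→F (suc k) = 1# + ℕ→F k

  IsProbDist : ∀ {n} → (Fin n → Carrier) → Set (ℓ₁ ⊔ ℓ₂)
  IsProbDist {n} μ = (∀ k → 0# ≤ μ k) × (sumF (map μ (allFin n)) ≈ 1#)

  IsCoupling : ∀ {d n} → (Fin d → Fin n → Carrier) → (Tuple d n → Carrier) → Set (ℓ₁ ⊔ ℓ₂)
  IsCoupling {d} {n} μ J =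
    (∀ m → 0# ≤ J m) ×
    (∀ i k → sumF (map J (filter (λ m → m i Fin.≟ k) (allTuples d n))) ≈ μ i k)

  totalCost : ∀ {d n} → (Tuple d n → Carrier) → Carrier
  totalCost {d} {n} J = sumF (map (λ m → ℕ→F (cost m) * J m) (allTuples d n))

  SupportIsChain : ∀ {d n} → (Tuple d n → Carrier) → Set ℓ₁
  SupportIsChain J = ∀ m m' → ¬ (J m ≈ 0#) → ¬ (J m' ≈ 0#) → (m ≤ₜ m') ⊎ (m' ≤ₜ m)

module Submission where

-- The comonotone coupling gives a tuple m the length of the cell ⋂ᵢ [Fᵢ(mᵢ), Fᵢ(mᵢ + 1)]
-- of [0, 1], where Fᵢ is the distribution function of μᵢ. The cells with mᵢ = k tile the
-- interval [Fᵢ(k), Fᵢ(k + 1)], so the marginals are the μᵢ, and two incomparable tuples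
-- cannot both have nonempty cells, so the support is a chain.
--
-- For optimality, cut the cost at thresholds t: with xⱼ = [mⱼ ≤ t] and a = Σⱼ xⱼ, the
-- minimum over i in C(m) is attained at a median coordinate, so C(m) = Σₜ min(a, d − a).
-- Sort the coordinates j by Fⱼ(t + 1) and let T and B be the last and the first ⌊d/2⌋ of
-- them. For every 0/1 vector x, Σ_T xⱼ − Σ_B xⱼ ≤ min(a, d − a), with equality when x is
-- nondecreasing along the sorted order, which is the case on the support of the
-- comonotone coupling. The left-hand side has expectation Σ_T Fⱼ(t + 1) − Σ_B Fⱼ(t + 1)
-- under every coupling, so the comonotone coupling minimises every threshold term.

open import Level using (Level)
open import Defs
open import Data.Nat as ℕ using (ℕ; zero; suc)
open import Data.Fin as Fin using (Fin; toℕ)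
open import Data.List using (List; []; _∷_; _++_; map; foldr; filter; concatMap; tabulate; length)
open import Data.List.Base using (allFin)
open import Data.Product using (∃; ∃₂; _×_; _,_; proj₁; proj₂)
open import Data.Sum using (_⊎_; inj₁; inj₂)
open import Data.Empty using (⊥; ⊥-elim)
open import Algebra.Bundles using (CommutativeMonoid)
import Relation.Binary.PropositionalEquality as ≡
open ≡ using (_≡_)

module ListSum {c ℓ} (M : CommutativeMonoid c ℓ) where
  open import Data.Bool using (if_then_else_; true; false)
  open import Data.List.Properties using (map-tabulate)
  open import Function using (id)
  open import Relation.Nullary using (Dec; yes; no; does)
  open import Relation.Unary using (Pred; Decidable)
  open import Relation.Binary.Core using (Rel; _Preserves₂_⟶_⟶_)
  open import Relation.Binary.Definitions using (Reflexive)
  open CommutativeMonoid M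
  open import Algebra.Properties.CommutativeSemigroup commutativeSemigroup using (interchange)
  open import Relation.Binary.Reasoning.Setoid setoid

  ∑ : ∀ {a} {A : Set a} → List A → (A → Carrier) → Carrier
  ∑ xs f = foldr _∙_ ε (map f xs)

  syntax ∑ xs (λ x → e) = ∑[ x ← xs ] e

  when : ∀ {p} {P : Set p} → Dec P → Carrier → Carrier
  when P? x = if does P? then x else ε

  private
    variable
      a b : Level
      A : Set a
      B : Set b

  ∑-cong : ∀ (xs : List A) {f g : A → Carrier} → (∀ x → f x ≈ g x) → ∑ xs f ≈ ∑ xs g
  ∑-cong []       f≈g = refl
  ∑-cong (x ∷ xs) f≈g = ∙-cong (f≈g x) (∑-cong xs f≈g)

  ∑-zero : ∀ (xs : List A) {f : A → Carrier} → (∀ x → f x ≈ ε) → ∑ xs f ≈ ε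
  ∑-zero []       f≈ε = refl
  ∑-zero (x ∷ xs) f≈ε = trans (∙-cong (f≈ε x) (∑-zero xs f≈ε)) (identityˡ ε)

  ∑-++ : ∀ (xs ys : List A) (f : A → Carrier) → ∑ (xs ++ ys) f ≈ ∑ xs f ∙ ∑ ys f
  ∑-++ []       ys f = sym (identityˡ _)
  ∑-++ (x ∷ xs) ys f = trans (∙-congˡ (∑-++ xs ys f)) (sym (assoc _ _ _))

  ∑-distrib : ∀ (xs : List A) (f g : A → Carrier) → ∑[ x ← xs ] (f x ∙ g x) ≈ ∑ xs f ∙ ∑ xs g
  ∑-distrib []       f g = sym (identityˡ ε)
  ∑-distrib (x ∷ xs) f g = trans (∙-congˡ (∑-distrib xs f g)) (interchange _ _ _ _)

  ∑-swap : ∀ (xs : List A) (ys : List B) (f : A → B → Carrier) →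
           ∑[ x ← xs ] ∑[ y ← ys ] f x y ≈ ∑[ y ← ys ] ∑[ x ← xs ] f x y
  ∑-swap []       ys f = sym (∑-zero ys (λ _ → refl))
  ∑-swap (x ∷ xs) ys f = trans (∙-congˡ (∑-swap xs ys f)) (sym (∑-distrib ys (f x) _))

  ∑-map : ∀ (xs : List A) (g : A → B) (f : B → Carrier) → ∑ (map g xs) f ≈ ∑[ x ← xs ] f (g x)
  ∑-map []       g f = refl
  ∑-map (x ∷ xs) g f = ∙-congˡ (∑-map xs g f)

  ∑-concatMap : ∀ (xs : List A) (g : A → List B) (f : B → Carrier) →
                ∑ (concatMap g xs) f ≈ ∑[ x ← xs ] ∑ (g x) f
  ∑-concatMap []       g f = refl
  ∑-concatMap (x ∷ xs) g f = trans (∑-++ (g x) (concatMap g xs) f) (∙-congˡ (∑-concatMap xs g f))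

  ∑-filter : ∀ {p} {P : Pred A p} (P? : Decidable P) xs (f : A → Carrier) →
             ∑ (filter P? xs) f ≈ ∑[ x ← xs ] when (P? x) (f x)
  ∑-filter P? []       f = refl
  ∑-filter P? (x ∷ xs) f with does (P? x)
  ... | true  = ∙-congˡ (∑-filter P? xs f)
  ... | false = trans (∑-filter P? xs f) (sym (identityˡ _))

  module _ {r} {_≤_ : Rel Carrier r} (≤-refl : Reflexive _≤_) (∙-mono : _∙_ Preserves₂ _≤_ ⟶ _≤_ ⟶ _≤_) where

    ∑-mono : ∀ (xs : List A) {f g : A → Carrier} → (∀ x → f x ≤ g x) → ∑ xs f ≤ ∑ xs g
    ∑-mono []       f≤g = ≤-refl
    ∑-mono (x ∷ xs) f≤g = ∙-mono (f≤g x) (∑-mono xs f≤g)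

  ∑-allFin-suc : ∀ {n} (f : Fin (suc n) → Carrier) →
                 ∑ (allFin (suc n)) f ≈ f Fin.zero ∙ ∑[ k ← allFin n ] f (Fin.suc k)
  ∑-allFin-suc {n} f = ∙-congˡ (reflexive (≡.cong (foldr _∙_ ε) shift))
    where
    shift : map f (tabulate (λ k → Fin.suc k)) ≡ map (λ k → f (Fin.suc k)) (allFin n)
    shift = ≡.trans (map-tabulate Fin.suc f) (≡.sym (map-tabulate id (λ k → f (Fin.suc k))))

  ∑-when-≡ : ∀ {n} (k : Fin n) (f : Fin n → Carrier) → ∑[ k′ ← allFin n ] when (k Fin.≟ k′) (f k′) ≈ f k
  ∑-when-≡ {suc n} Fin.zero    f = begin
    ∑[ k′ ← allFin (suc n) ] when (Fin.zero Fin.≟ k′) (f k′)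
      ≈⟨ ∑-allFin-suc (λ k′ → when (Fin.zero Fin.≟ k′) (f k′)) ⟩
    f Fin.zero ∙ ∑[ k′ ← allFin n ] ε ≈⟨ ∙-congˡ (∑-zero (allFin n) (λ _ → refl)) ⟩
    f Fin.zero ∙ ε                    ≈⟨ identityʳ _ ⟩
    f Fin.zero                        ∎
  ∑-when-≡ {suc n} (Fin.suc k) f = begin
    ∑[ k′ ← allFin (suc n) ] when (Fin.suc k Fin.≟ k′) (f k′)
      ≈⟨ ∑-allFin-suc (λ k′ → when (Fin.suc k Fin.≟ k′) (f k′)) ⟩
    ε ∙ ∑[ k′ ← allFin n ] when (Fin.suc k Fin.≟ Fin.suc k′) (f (Fin.suc k′))
      ≈⟨ identityˡ _ ⟩
    ∑[ k′ ← allFin n ] when (Fin.suc k Fin.≟ Fin.suc k′) (f (Fin.suc k′))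
      ≈⟨ ∑-cong (allFin n) peel ⟩
    ∑[ k′ ← allFin n ] when (k Fin.≟ k′) (f (Fin.suc k′))
      ≈⟨ ∑-when-≡ k (λ k′ → f (Fin.suc k′)) ⟩
    f (Fin.suc k) ∎
    where
    peel : ∀ k′ → when (Fin.suc k Fin.≟ Fin.suc k′) (f (Fin.suc k′)) ≈ when (k Fin.≟ k′) (f (Fin.suc k′))
    peel k′ with k Fin.≟ k′
    ... | yes _ = refl
    ... | no  _ = refl

module StepFunction where
  open ≡ using (_≢_; refl; cong; cong₂; sym; trans)
  open import Data.Nat using (_+_; _≤_; _<_; _⊓_; ∣_-_∣; z≤n; s≤s)
  open import Data.Nat.Properties
  open import Relation.Nullary using (yes; no)
  open ListSum +-0-commutativeMonoid

  step : ℕ → ℕ → ℕ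
  step a       zero    = 0
  step zero    (suc s) = 1
  step (suc a) (suc s) = step a s

  <⇒step≡1 : ∀ {a s} → a < s → step a s ≡ 1
  <⇒step≡1 {zero}  {suc s} _         = refl
  <⇒step≡1 {suc a} {suc s} (s≤s a<s) = <⇒step≡1 a<s

  ≥⇒step≡0 : ∀ {a s} → s ≤ a → step a s ≡ 0
  ≥⇒step≡0 {a}     {zero}  _         = refl
  ≥⇒step≡0 {suc a} {suc s} (s≤s s≤a) = ≥⇒step≡0 s≤a

  step≡1⇒< : ∀ {a s} → step a s ≡ 1 → a < s
  step≡1⇒< {zero}  {suc s} _ = s≤s z≤n
  step≡1⇒< {suc a} {suc s} e = s≤s (step≡1⇒< e)

  step≡0⇒≥ : ∀ {a s} → step a s ≡ 0 → s ≤ a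
  step≡0⇒≥ {a}     {zero}  _ = z≤n
  step≡0⇒≥ {suc a} {suc s} e = s≤s (step≡0⇒≥ e)

  step≤1 : ∀ a s → step a s ≤ 1
  step≤1 a       zero    = z≤n
  step≤1 zero    (suc s) = ≤-refl
  step≤1 (suc a) (suc s) = step≤1 a s

  step-monoʳ-≤ : ∀ a {s s′} → s ≤ s′ → step a s ≤ step a s′
  step-monoʳ-≤ a {s} s≤s′ with a <? s
  ... | yes a<s = ≤-reflexive (trans (<⇒step≡1 a<s) (sym (<⇒step≡1 (<-≤-trans a<s s≤s′))))
  ... | no  a≮s = ≤-trans (≤-reflexive (≥⇒step≡0 (≮⇒≥ a≮s))) z≤n

  step-suc-≢ : ∀ {a s} → a ≢ s → step a (suc s) ≡ step a s
  step-suc-≢ {zero}  {zero}  a≢s = ⊥-elim (a≢s refl)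
  step-suc-≢ {zero}  {suc s} a≢s = refl
  step-suc-≢ {suc a} {zero}  a≢s = refl
  step-suc-≢ {suc a} {suc s} a≢s = step-suc-≢ (λ a≡s → a≢s (cong suc a≡s))

  step-jump : ∀ {a s} → step a s < step a (suc s) → a ≡ s
  step-jump {zero}  {zero}  _         = refl
  step-jump {zero}  {suc s} (s≤s ())
  step-jump {suc a} {zero}  ()
  step-jump {suc a} {suc s} lt        = cong suc (step-jump lt)

  ∑∣1-step∣ : ∀ N y → ∑[ t ← allFin N ] ∣ 1 - step y (suc (toℕ t)) ∣ ≡ y ⊓ N
  ∑∣1-step∣ zero    y       = sym (⊓-zeroʳ y)
  ∑∣1-step∣ (suc N) y = trans (∑-allFin-suc {N} (λ t → ∣ 1 - step y (suc (toℕ t)) ∣)) (shift y)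
    where
    shift : ∀ y → ∣ 1 - step y 1 ∣ + (∑[ t ← allFin N ] ∣ 1 - step y (suc (suc (toℕ t))) ∣) ≡ y ⊓ suc N
    shift zero    = ∑∣1-step∣ N zero
    shift (suc y) = cong suc (∑∣1-step∣ N y)

  ∑∣step-step∣ : ∀ N x y →
    ∑[ t ← allFin N ] ∣ step x (suc (toℕ t)) - step y (suc (toℕ t)) ∣ ≡ ∣ x ⊓ N - y ⊓ N ∣
  ∑∣step-step∣ zero    x       y       rewrite ⊓-zeroʳ x | ⊓-zeroʳ y = refl
  ∑∣step-step∣ (suc N) x y =
    trans (∑-allFin-suc {N} (λ t → ∣ step x (suc (toℕ t)) - step y (suc (toℕ t)) ∣)) (shift x y)
    where
    shift : ∀ x y → ∣ step x 1 - step y 1 ∣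
                    + (∑[ t ← allFin N ] ∣ step x (suc (suc (toℕ t))) - step y (suc (suc (toℕ t))) ∣)
                    ≡ ∣ x ⊓ suc N - y ⊓ suc N ∣
    shift zero    zero    = ∑∣step-step∣ N zero zero
    shift zero    (suc y) = cong suc (∑∣1-step∣ N y)
    shift (suc x) zero    =
      cong suc (trans (∑-cong (allFin N) (λ t → ∣-∣-comm (step x (suc (toℕ t))) 1)) (∑∣1-step∣ N x))
    shift (suc x) (suc y) = ∑∣step-step∣ N x y

  ∣-∣≡∑∣step-step∣ : ∀ {N x y} → x < N → y < N →
    ∣ x - y ∣ ≡ ∑[ t ← allFin N ] ∣ step x (suc (toℕ t)) - step y (suc (toℕ t)) ∣
  ∣-∣≡∑∣step-step∣ {N} {x} {y} x<N y<N =
    trans (cong₂ ∣_-_∣ (sym (m≤n⇒m⊓n≡m (<⇒≤ x<N))) (sym (m≤n⇒m⊓n≡m (<⇒≤ y<N))))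
          (sym (∑∣step-step∣ N x y))

module NatSums where
  open ≡ using (refl; cong; trans)
  open import Data.List.Properties using (length-tabulate)
  open import Data.Nat using (_+_; _≤_; _<_; ∣_-_∣; s≤s)
  open import Data.Nat.Properties
  open import Relation.Nullary using (yes; no)
  open ListSum +-0-commutativeMonoid

  ∑-mono-≤ : ∀ {a} {A : Set a} (xs : List A) {f g : A → ℕ} → (∀ x → f x ≤ g x) → ∑ xs f ≤ ∑ xs g
  ∑-mono-≤ = ∑-mono {_≤_ = _≤_} ≤-refl +-mono-≤

  length-allFin : ∀ k → length (allFin k) ≡ k
  length-allFin k = length-tabulate (λ i → i)

  ∑-const-1 : ∀ {a} {A : Set a} (xs : List A) → ∑[ x ← xs ] 1 ≡ length xs
  ∑-const-1 []       = refl
  ∑-const-1 (x ∷ xs) = cong suc (∑-const-1 xs)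

  ∑≤length : ∀ {a} {A : Set a} (xs : List A) {f : A → ℕ} → (∀ x → f x ≤ 1) → ∑ xs f ≤ length xs
  ∑≤length xs f≤1 = ≤-trans (∑-mono-≤ xs f≤1) (≤-reflexive (∑-const-1 xs))

  ∑∣1-f∣+∑f≡length : ∀ {a} {A : Set a} (xs : List A) {f : A → ℕ} → (∀ x → f x ≤ 1) →
                     ∑[ x ← xs ] ∣ 1 - f x ∣ + ∑ xs f ≡ length xs
  ∑∣1-f∣+∑f≡length []       f≤1 = refl
  ∑∣1-f∣+∑f≡length (x ∷ xs) {f} f≤1 with f x | f≤1 x
  ... | 0 | _       = cong suc (∑∣1-f∣+∑f≡length xs f≤1)
  ... | 1 | _       = trans (+-suc _ _) (cong suc (∑∣1-f∣+∑f≡length xs f≤1))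
  ... | suc (suc _) | s≤s ()

  ∑<∑⇒∃< : ∀ {a} {A : Set a} (xs : List A) (f g : A → ℕ) → ∑ xs f < ∑ xs g → ∃ λ x → f x < g x
  ∑<∑⇒∃< (x ∷ xs) f g lt with f x <? g x
  ... | yes fx<gx = x , fx<gx
  ... | no  fx≮gx = ∑<∑⇒∃< xs f g (+-cancelˡ-< (g x) _ _ (≤-<-trans (+-monoˡ-≤ (∑ xs f) (≮⇒≥ fx≮gx)) lt))

  m+m<n+n⇒m<n : ∀ {m n} → m + m < n + n → m < n
  m+m<n+n⇒m<n lt = ≰⇒> (λ n≤m → <⇒≱ lt (+-mono-≤ n≤m n≤m))

  crossing : ∀ (f : ℕ → ℕ) {c} N → f 0 < c → c ≤ f N → ∃ λ v → f v < c × c ≤ f (suc v)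
  crossing f zero    f0<c c≤f0 = ⊥-elim (<⇒≱ f0<c c≤f0)
  crossing f (suc N) f0<c c≤fN with _ ≤? f N
  ... | yes c≤fN = crossing f N f0<c c≤fN
  ... | no  c≰fN = N , ≰⇒> c≰fN , c≤fN

module MedianCost (d′ n : ℕ) where
  open ≡ using (refl; cong; cong₂; sym; trans)
  open import Data.Nat using (_+_; _≤_; _<_; _⊓_; _∸_; ∣_-_∣; z≤n; s≤s)
  open import Data.Nat.Properties
  import Data.Fin.Properties as Finₚ
  open import Data.List.Membership.Propositional using (_∈_)
  open import Data.List.Membership.Propositional.Properties using (∈-allFin)
  open import Data.List.Relation.Unary.Any using (here; there)
  open import Relation.Nullary using (yes; no)
  open ListSum +-0-commutativeMonoid
  open StepFunction
  open NatSums

  d : ℕ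
  d = suc d′

  below : Tuple d n → ℕ → ℕ
  below m s = ∑[ j ← allFin d ] step (toℕ (m j)) s

  minorityAt : Tuple d n → ℕ → ℕ
  minorityAt m s = below m s ⊓ (d ∸ below m s)

  spread : Tuple d n → Fin d → ℕ
  spread m i = ∑[ j ← allFin d ] ∣ toℕ (m i) - toℕ (m j) ∣

  spreadAt : Tuple d n → Fin d → ℕ → ℕ
  spreadAt m i s = ∑[ j ← allFin d ] ∣ step (toℕ (m i)) s - step (toℕ (m j)) s ∣

  below-0 : ∀ m → below m 0 ≡ 0
  below-0 m = ∑-zero (allFin d) (λ j → refl)

  below-n : ∀ m → below m n ≡ d
  below-n m = trans (∑-cong (allFin d) (λ j → <⇒step≡1 (Finₚ.toℕ<n (m j))))
                    (trans (∑-const-1 (allFin d)) (length-allFin d))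

  below-mono : ∀ m {s s′} → s ≤ s′ → below m s ≤ below m s′
  below-mono m s≤s′ = ∑-mono-≤ (allFin d) (λ j → step-monoʳ-≤ (toℕ (m j)) s≤s′)

  spread≡∑spreadAt : ∀ m i → spread m i ≡ ∑[ t ← allFin n ] spreadAt m i (suc (toℕ t))
  spread≡∑spreadAt m i = trans
    (∑-cong (allFin d) (λ j → ∣-∣≡∑∣step-step∣ (Finₚ.toℕ<n (m i)) (Finₚ.toℕ<n (m j))))
    (∑-swap (allFin d) (allFin n) (λ j t → ∣ step (toℕ (m i)) (suc (toℕ t)) - step (toℕ (m j)) (suc (toℕ t)) ∣))

  spreadAt-below : ∀ m i s → step (toℕ (m i)) s ≡ 0 → spreadAt m i s ≡ below m s
  spreadAt-below m i s e rewrite e = refl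

  spreadAt-above : ∀ m i s → step (toℕ (m i)) s ≡ 1 → spreadAt m i s ≡ d ∸ below m s
  spreadAt-above m i s e rewrite e = trans (sym (m+n∸n≡m _ (below m s)))
    (cong (_∸ below m s) (trans (∑∣1-f∣+∑f≡length (allFin d) (λ j → step≤1 (toℕ (m j)) s)) (length-allFin d)))

  minorityAt≤spreadAt : ∀ m i s → minorityAt m s ≤ spreadAt m i s
  minorityAt≤spreadAt m i s with toℕ (m i) <? s
  ... | yes mi<s = ≤-trans (m⊓n≤n _ _) (≤-reflexive (sym (spreadAt-above m i s (<⇒step≡1 mi<s))))
  ... | no  mi≮s = ≤-trans (m⊓n≤m _ _) (≤-reflexive (sym (spreadAt-below m i s (≥⇒step≡0 (≮⇒≥ mi≮s)))))

  -- A coordinate sitting where 2 · below m crosses d is a median.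
  median : ∀ m → ∃ λ i → ∀ t → spreadAt m i (suc t) ≤ minorityAt m (suc t)
  median m = i , bound
    where
    twice : ℕ → ℕ
    twice s = below m s + below m s

    twice-0<d : twice 0 < d
    twice-0<d = ≤-trans (≤-reflexive (cong suc (cong₂ _+_ (below-0 m) (below-0 m)))) (s≤s z≤n)

    d≤twice-n : d ≤ twice n
    d≤twice-n = ≤-trans (m≤m+n d d) (≤-reflexive (cong₂ _+_ (sym (below-n m)) (sym (below-n m))))

    crossing-point : ∃ λ v → twice v < d × d ≤ twice (suc v)
    crossing-point = crossing twice n twice-0<d d≤twice-n

    v : ℕ
    v = proj₁ crossing-point

    jumping-coordinate : ∃ λ i → step (toℕ (m i)) v < step (toℕ (m i)) (suc v)
    jumping-coordinate = ∑<∑⇒∃< (allFin d) _ _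
      (m+m<n+n⇒m<n (<-≤-trans (proj₁ (proj₂ crossing-point)) (proj₂ (proj₂ crossing-point))))

    i : Fin d
    i = proj₁ jumping-coordinate

    mi≡v : toℕ (m i) ≡ v
    mi≡v = step-jump (proj₂ jumping-coordinate)

    bound : ∀ t → spreadAt m i (suc t) ≤ minorityAt m (suc t)
    bound t with v ≤? t
    ... | yes v≤t = ≤-trans (≤-reflexive (spreadAt-above m i (suc t) (<⇒step≡1 (s≤s (≤-trans (≤-reflexive mi≡v) v≤t)))))
                            (⊓-glb d∸b≤b ≤-refl)
      where
      d∸b≤b : d ∸ below m (suc t) ≤ below m (suc t)
      d∸b≤b = ≤-trans (∸-monoˡ-≤ (below m (suc t))
                (≤-trans (proj₂ (proj₂ crossing-point)) (+-mono-≤ (below-mono m (s≤s v≤t)) (below-mono m (s≤s v≤t)))))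
                (≤-reflexive (m+n∸n≡m (below m (suc t)) (below m (suc t))))
    ... | no  v≰t = ≤-trans (≤-reflexive (spreadAt-below m i (suc t) (≥⇒step≡0 (≤-trans t<v (≤-reflexive (sym mi≡v))))))
                            (⊓-glb ≤-refl b≤d∸b)
      where
      t<v : suc t ≤ v
      t<v = ≰⇒> v≰t
      b≤d∸b : below m (suc t) ≤ d ∸ below m (suc t)
      b≤d∸b = m+n≤o⇒m≤o∸n _
        (≤-trans (+-mono-≤ (below-mono m t<v) (below-mono m t<v)) (<⇒≤ (proj₁ (proj₂ crossing-point))))

  minList-lb : ∀ {a} {A : Set a} (f : A → ℕ) {xs x} → x ∈ xs → minList (map f xs) ≤ f x
  minList-lb f {_ ∷ []}    (here refl) = ≤-refl
  minList-lb f {_ ∷ _ ∷ _} (here refl) = m⊓n≤m _ _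
  minList-lb f {y ∷ _ ∷ _} (there x∈) = ≤-trans (m⊓n≤n (f y) _) (minList-lb f x∈)

  minList-glb : ∀ {a} {A : Set a} (f : A → ℕ) {b} x xs → (∀ y → b ≤ f y) → b ≤ minList (map f (x ∷ xs))
  minList-glb f x []       b≤f = b≤f x
  minList-glb f x (y ∷ xs) b≤f = ⊓-glb (b≤f x) (minList-glb f y xs b≤f)

  cost≡∑minorityAt : ∀ m → cost m ≡ ∑[ t ← allFin n ] minorityAt m (suc (toℕ t))
  cost≡∑minorityAt m = ≤-antisym upper lower
    where
    ∑minority≤spread : ∀ i → ∑[ t ← allFin n ] minorityAt m (suc (toℕ t)) ≤ spread m i
    ∑minority≤spread i = ≤-trans (∑-mono-≤ (allFin n) (λ t → minorityAt≤spreadAt m i (suc (toℕ t))))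
                                 (≤-reflexive (sym (spread≡∑spreadAt m i)))

    lower : ∑[ t ← allFin n ] minorityAt m (suc (toℕ t)) ≤ cost m
    lower = minList-glb (spread m) Fin.zero (tabulate Fin.suc) ∑minority≤spread

    upper : cost m ≤ ∑[ t ← allFin n ] minorityAt m (suc (toℕ t))
    upper with median m
    ... | i , spreadAt≤minority = ≤-trans (minList-lb (spread m) (∈-allFin i))
      (≤-trans (≤-reflexive (spread≡∑spreadAt m i)) (∑-mono-≤ (allFin n) (λ t → spreadAt≤minority (toℕ t))))

-- Data.List.Sort needs a decidable order; an ordered field only provides totality.
module InsertionSort {a r} {A : Set a} (_≼_ : A → A → Set r)
                     (≼-total : ∀ x y → x ≼ y ⊎ y ≼ x) (≼-trans : ∀ {x y z} → x ≼ y → y ≼ z → x ≼ z) where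
  open import Data.List.Relation.Unary.All as All using (All; _∷_)
  open import Data.List.Relation.Unary.AllPairs using (AllPairs; []; _∷_)
  open import Data.List.Relation.Binary.Permutation.Propositional using (_↭_; ↭-refl; ↭-prep; ↭-swap; ↭-trans; ↭-sym)
  open import Data.List.Relation.Binary.Permutation.Propositional.Properties using (All-resp-↭)

  insert : A → List A → List A
  insert x []       = x ∷ []
  insert x (y ∷ ys) with ≼-total x y
  ... | inj₁ _ = x ∷ y ∷ ys
  ... | inj₂ _ = y ∷ insert x ys

  sort : List A → List A
  sort = foldr insert []

  insert-↭ : ∀ x ys → insert x ys ↭ x ∷ ys
  insert-↭ x []       = ↭-refl
  insert-↭ x (y ∷ ys) with ≼-total x y
  ... | inj₁ _ = ↭-refl
  ... | inj₂ _ = ↭-trans (↭-prep y (insert-↭ x ys)) (↭-swap y x ↭-refl)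

  sort-↭ : ∀ xs → sort xs ↭ xs
  sort-↭ []       = ↭-refl
  sort-↭ (x ∷ xs) = ↭-trans (insert-↭ x (sort xs)) (↭-prep x (sort-↭ xs))

  insert-sorted : ∀ x ys → AllPairs _≼_ ys → AllPairs _≼_ (insert x ys)
  insert-sorted x []       []                = All.[] ∷ []
  insert-sorted x (y ∷ ys) (y≼ys ∷ ys-sorted) with ≼-total x y
  ... | inj₁ x≼y = (x≼y ∷ All.map (≼-trans x≼y) y≼ys) ∷ y≼ys ∷ ys-sorted
  ... | inj₂ y≼x = All-resp-↭ (↭-sym (insert-↭ x ys)) (y≼x ∷ y≼ys) ∷ insert-sorted x ys ys-sorted

  sort-sorted : ∀ xs → AllPairs _≼_ (sort xs)
  sort-sorted []       = []
  sort-sorted (x ∷ xs) = insert-sorted x (sort xs) (sort-sorted xs)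

module BinaryLists where
  open ≡ using (refl; cong; sym; trans)
  open import Data.Nat using (_+_; _≤_; _<_; _⊓_; _∸_; z≤n; s≤s)
  open import Data.Nat.Properties
  open import Data.Nat.ListAction using (sum)
  open import Data.Nat.ListAction.Properties using (sum-++)
  open import Data.Nat.Solver using (module +-*-Solver)
  open +-*-Solver using (solve; _:+_; _:=_)
  open import Data.List using (take; drop)
  open import Data.List.Properties using (take++drop≡id; length-take; length-drop; take-take)
  open import Data.List.Relation.Unary.All as All using (All; []; _∷_)
  open import Data.List.Relation.Unary.All.Properties using (take⁺; drop⁺)
  open import Data.List.Relation.Unary.AllPairs using (AllPairs; []; _∷_)
  import Data.Sum as Sum
  open import Relation.Nullary using (yes; no)
  open ≤-Reasoning

  data ZerosThenOnes : List ℕ → Set where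
    ones   : ∀ {ys} → All (_≡ 1) ys → ZerosThenOnes ys
    zero∷_ : ∀ {ys} → ZerosThenOnes ys → ZerosThenOnes (0 ∷ ys)

  minority : List ℕ → ℕ
  minority ys = sum ys ⊓ (length ys ∸ sum ys)

  sum≤length : ∀ {ys} → All (_≤ 1) ys → sum ys ≤ length ys
  sum≤length []         = z≤n
  sum≤length (y≤1 ∷ ys) = +-mono-≤ y≤1 (sum≤length ys)

  sum-take+sum-drop : ∀ k ys → sum (take k ys) + sum (drop k ys) ≡ sum ys
  sum-take+sum-drop k ys = trans (sym (sum-++ (take k ys) (drop k ys))) (cong sum (take++drop≡id k ys))

  ones-sum : ∀ {ys} → All (_≡ 1) ys → sum ys ≡ length ys
  ones-sum []          = refl
  ones-sum (refl ∷ ps) = cong suc (ones-sum ps)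

  ones-sum-take : ∀ k {ys} → All (_≡ 1) ys → sum (take k ys) ≡ k ⊓ length ys
  ones-sum-take zero    _           = refl
  ones-sum-take (suc k) []          = refl
  ones-sum-take (suc k) (refl ∷ ps) = cong suc (ones-sum-take k ps)

  ones-sum-drop : ∀ k {ys} → All (_≡ 1) ys → sum (drop k ys) ≡ length ys ∸ k
  ones-sum-drop zero    ps          = ones-sum ps
  ones-sum-drop (suc k) []          = refl
  ones-sum-drop (suc k) (refl ∷ ps) = ones-sum-drop k ps

  zerosThenOnes-≤1 : ∀ {ys} → ZerosThenOnes ys → All (_≤ 1) ys
  zerosThenOnes-≤1 (ones ps) = All.map ≤-reflexive ps
  zerosThenOnes-≤1 (zero∷ p) = z≤n ∷ zerosThenOnes-≤1 p

  zerosThenOnes-sum-take : ∀ k {ys} → ZerosThenOnes ys → k ≤ length ys → sum (take k ys) ≡ k ∸ (length ys ∸ sum ys)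
  zerosThenOnes-sum-take k {ys} (ones ps) k≤len = begin-equality
    sum (take k ys)                ≡⟨ ones-sum-take k ps ⟩
    k ⊓ length ys                  ≡⟨ m≤n⇒m⊓n≡m k≤len ⟩
    k                              ≡⟨ cong (k ∸_) (trans (cong (length ys ∸_) (ones-sum ps)) (n∸n≡0 (length ys))) ⟨
    k ∸ (length ys ∸ sum ys)       ∎
  zerosThenOnes-sum-take zero    {_ ∷ ys} (zero∷ p) _           = sym (0∸n≡0 (suc (length ys) ∸ sum ys))
  zerosThenOnes-sum-take (suc k) {_ ∷ ys} (zero∷ p) (s≤s k≤len) = begin-equality
    sum (take k ys)                ≡⟨ zerosThenOnes-sum-take k p k≤len ⟩
    k ∸ (length ys ∸ sum ys)       ≡⟨ cong (suc k ∸_) (+-∸-assoc 1 (sum≤length (zerosThenOnes-≤1 p))) ⟨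
    suc k ∸ (suc (length ys) ∸ sum ys) ∎

  zerosThenOnes-sum-drop : ∀ k {ys} → ZerosThenOnes ys → sum (drop k ys) ≡ sum ys ⊓ (length ys ∸ k)
  zerosThenOnes-sum-drop k {ys} (ones ps) = begin-equality
    sum (drop k ys)                ≡⟨ ones-sum-drop k ps ⟩
    length ys ∸ k                  ≡⟨ m≥n⇒m⊓n≡n (m∸n≤m (length ys) k) ⟨
    length ys ⊓ (length ys ∸ k)    ≡⟨ cong (_⊓ (length ys ∸ k)) (ones-sum ps) ⟨
    sum ys ⊓ (length ys ∸ k)       ∎
  zerosThenOnes-sum-drop zero    (zero∷ p) = sym (m≤n⇒m⊓n≡m (≤-trans (sum≤length (zerosThenOnes-≤1 p)) (n≤1+n _)))
  zerosThenOnes-sum-drop (suc k) (zero∷ p) = zerosThenOnes-sum-drop k p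

  module _ {a r} {A : Set a} (_≼_ : A → A → Set r) (x : A → ℕ) (x≤1 : ∀ a → x a ≤ 1) where

    ones-or-zero : ∀ {a} bs → All (a ≼_) bs → All (_≡ 1) (map x bs) ⊎ ∃ λ b → a ≼ b × x b ≡ 0
    ones-or-zero []       []           = inj₁ []
    ones-or-zero (b ∷ bs) (a≼b ∷ a≼bs) with x b in xb≡ | x≤1 b
    ... | 0           | _      = inj₂ (b , a≼b , xb≡)
    ... | 1           | _      = Sum.map₁ (refl ∷_) (ones-or-zero bs a≼bs)
    ... | suc (suc _) | s≤s ()

    zerosThenOnes-or-inversion : ∀ as → AllPairs _≼_ as →
      ZerosThenOnes (map x as) ⊎ ∃₂ λ a b → a ≼ b × x a ≡ 1 × x b ≡ 0
    zerosThenOnes-or-inversion []       []                = inj₁ (ones [])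
    zerosThenOnes-or-inversion (a ∷ as) (a≼as ∷ as-sorted) with x a in xa≡ | x≤1 a
    ... | 0           | _      = Sum.map₁ zero∷_ (zerosThenOnes-or-inversion as as-sorted)
    ... | 1           | _      = Sum.map (λ all-ones → ones (refl ∷ all-ones))
                                         (λ (b , a≼b , xb≡0) → a , b , a≼b , xa≡ , xb≡0)
                                         (ones-or-zero as a≼as)
    ... | suc (suc _) | s≤s ()

  a⊓z+[h∸z]≤a⊓h : ∀ {a z h w} → z + a ≡ h + (h + w) → w ≤ 1 → a ⊓ z + (h ∸ z) ≤ a ⊓ h
  a⊓z+[h∸z]≤a⊓h {a} {z} {h} {w} z+a≡ w≤1 with h ≤? z
  ... | yes h≤z = begin
    a ⊓ z + (h ∸ z) ≡⟨ cong (a ⊓ z +_) (m≤n⇒m∸n≡0 h≤z) ⟩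
    a ⊓ z + 0       ≡⟨ +-identityʳ (a ⊓ z) ⟩
    a ⊓ z           ≤⟨ ⊓-glb (m⊓n≤m a z) a⊓z≤h ⟩
    a ⊓ h           ∎
    where
    a⊓z≤h : a ⊓ z ≤ h
    a⊓z≤h with a ≤? h
    ... | yes a≤h = ≤-trans (m⊓n≤m a z) a≤h
    ... | no  a≰h = ≤-trans (m⊓n≤n a z) (+-cancelʳ-≤ (suc h) z h (begin
      z + suc h       ≤⟨ +-monoʳ-≤ z (≰⇒> a≰h) ⟩
      z + a           ≡⟨ z+a≡ ⟩
      h + (h + w)     ≤⟨ +-monoʳ-≤ h (≤-trans (+-monoʳ-≤ h w≤1) (≤-reflexive (+-comm h 1))) ⟩
      h + suc h       ∎))
  ... | no h≰z = ⊓-glb (≤-trans a⊓z+[h∸z]≤h h≤a) a⊓z+[h∸z]≤h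
    where
    z<h : z < h
    z<h = ≰⇒> h≰z
    a⊓z+[h∸z]≤h : a ⊓ z + (h ∸ z) ≤ h
    a⊓z+[h∸z]≤h = ≤-trans (+-monoˡ-≤ (h ∸ z) (m⊓n≤n a z)) (≤-reflexive (m+[n∸m]≡n (<⇒≤ z<h)))
    h≤a : h ≤ a
    h≤a = <⇒≤ (+-cancelˡ-< z h a (begin-strict
      z + h           <⟨ +-monoˡ-< h z<h ⟩
      h + h           ≤⟨ +-monoʳ-≤ h (m≤m+n h w) ⟩
      h + (h + w)     ≡⟨ z+a≡ ⟨
      z + a           ∎))

  sum-drop≤minority+sum-take : ∀ {ys} h w → All (_≤ 1) ys → length ys ≡ h + (h + w) →
                               sum (drop (h + w) ys) ≤ minority ys + sum (take h ys)
  sum-drop≤minority+sum-take {ys} h w ys≤1 len≡ = begin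
    B                 ≤⟨ ⊓-glb B≤a+F B≤z+F ⟩
    (a + F) ⊓ (z + F) ≡⟨ +-distribʳ-⊓ F a z ⟨
    a ⊓ z + F         ∎
    where
    a z B F P : ℕ
    a = sum ys
    z = length ys ∸ a
    B = sum (drop (h + w) ys)
    F = sum (take h ys)
    P = sum (take (h + w) ys)

    P+B≡a : P + B ≡ a
    P+B≡a = sum-take+sum-drop (h + w) ys

    B≤a+F : B ≤ a + F
    B≤a+F = ≤-trans (m≤n+m B P) (≤-trans (≤-reflexive P+B≡a) (m≤m+n a F))

    B≤h : B ≤ h
    B≤h = ≤-trans (sum≤length (drop⁺ (h + w) ys≤1))
      (≤-reflexive (trans (length-drop (h + w) ys) (trans (cong (_∸ (h + w)) len≡) (m+n∸n≡m h (h + w)))))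

    P≤F+w : P ≤ F + w
    P≤F+w = begin
      P                                                     ≡⟨ sum-take+sum-drop h (take (h + w) ys) ⟨
      sum (take h (take (h + w) ys)) + sum (drop h (take (h + w) ys))
        ≡⟨ cong (λ l → sum l + sum (drop h (take (h + w) ys)))
                (trans (take-take h (h + w) ys) (cong (λ k → take k ys) (m≤n⇒m⊓n≡m (m≤m+n h w)))) ⟩
      F + sum (drop h (take (h + w) ys))                    ≤⟨ +-monoʳ-≤ F middle≤w ⟩
      F + w                                                 ∎
      where
      middle≤w : sum (drop h (take (h + w) ys)) ≤ w
      middle≤w = ≤-trans (sum≤length (drop⁺ h (take⁺ (h + w) ys≤1))) (begin
        length (drop h (take (h + w) ys)) ≡⟨ length-drop h (take (h + w) ys) ⟩
        length (take (h + w) ys) ∸ h      ≤⟨ ∸-monoˡ-≤ h (≤-trans (≤-reflexive (length-take (h + w) ys)) (m⊓n≤m _ _)) ⟩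
        (h + w) ∸ h                       ≡⟨ m+n∸m≡n h w ⟩
        w                                 ∎)

    B≤z+F : B ≤ z + F
    B≤z+F = +-cancelʳ-≤ a B (z + F) (begin
      B + a             ≡⟨ cong (B +_) P+B≡a ⟨
      B + (P + B)       ≤⟨ +-mono-≤ B≤h (+-mono-≤ P≤F+w B≤h) ⟩
      h + ((F + w) + h) ≡⟨ solve 3 (λ h F w → h :+ ((F :+ w) :+ h) := (h :+ (h :+ w)) :+ F) refl h F w ⟩
      h + (h + w) + F   ≡⟨ cong (_+ F) (trans (m∸n+n≡m (sum≤length ys≤1)) len≡) ⟨
      z + a + F         ≡⟨ solve 3 (λ z a F → (z :+ a) :+ F := (z :+ F) :+ a) refl z a F ⟩
      z + F + a         ∎)

  minority+sum-take≤sum-drop : ∀ {ys} h w → w ≤ 1 → ZerosThenOnes ys → length ys ≡ h + (h + w) →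
                               minority ys + sum (take h ys) ≤ sum (drop (h + w) ys)
  minority+sum-take≤sum-drop {ys} h w w≤1 p len≡ = begin
    a ⊓ z + sum (take h ys) ≡⟨ cong (a ⊓ z +_) (zerosThenOnes-sum-take h p h≤len) ⟩
    a ⊓ z + (h ∸ z)         ≤⟨ a⊓z+[h∸z]≤a⊓h z+a≡ w≤1 ⟩
    a ⊓ h                   ≡⟨ cong (a ⊓_) len∸[h+w]≡h ⟨
    a ⊓ (length ys ∸ (h + w)) ≡⟨ zerosThenOnes-sum-drop (h + w) p ⟨
    sum (drop (h + w) ys)   ∎
    where
    a z : ℕ
    a = sum ys
    z = length ys ∸ a
    z+a≡ : z + a ≡ h + (h + w)
    z+a≡ = trans (m∸n+n≡m (sum≤length (zerosThenOnes-≤1 p))) len≡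
    h≤len : h ≤ length ys
    h≤len = ≤-trans (m≤m+n h (h + w)) (≤-reflexive (sym len≡))
    len∸[h+w]≡h : length ys ∸ (h + w) ≡ h
    len∸[h+w]≡h = trans (cong (_∸ (h + w)) len≡) (m+n∸n≡m h (h + w))

  halve : ∀ d → ∃₂ λ h w → w ≤ 1 × d ≡ h + (h + w)
  halve zero          = 0 , 0 , z≤n , refl
  halve (suc zero)    = 0 , 1 , s≤s z≤n , refl
  halve (suc (suc d)) with halve d
  ... | h , w , w≤1 , d≡ = suc h , w , w≤1 , cong suc (trans (cong suc d≡) (sym (+-suc h (h + w))))

module OrderedFieldProperties {c ℓ₁ ℓ₂} (F : OrderedField c ℓ₁ ℓ₂) where
  -- Defs declares no fixity for _≤_.
  open OrderedField F public renaming (_≤_ to infix 4 _≤_; +-mono-≤ to +-monoˡ-≤)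
  open import Algebra.Properties.Ring ring using (//-rightDividesˡ; //-rightDividesʳ; -‿distribˡ-*; -1*x≈-x; -‿involutive)
  open import Relation.Binary.Bundles using (TotalOrder)

  totalOrder : TotalOrder c ℓ₁ ℓ₂
  totalOrder = record { isTotalOrder = isTotalOrder }

  open TotalOrder totalOrder public
    using (poset; total)
    renaming (refl to ≤-refl; trans to ≤-trans; reflexive to ≤-reflexive; antisym to ≤-antisym)
  open import Algebra.Construct.NaturalChoice.Min totalOrder public
  open import Algebra.Construct.NaturalChoice.Max totalOrder public
  open import Relation.Binary.Reasoning.PartialOrder poset

  +-monoʳ-≤ : ∀ z {x y} → x ≤ y → z + x ≤ z + y
  +-monoʳ-≤ z {x} {y} x≤y = begin
    z + x ≈⟨ +-comm z x ⟩
    x + z ≤⟨ +-monoˡ-≤ z x≤y ⟩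
    y + z ≈⟨ +-comm y z ⟩
    z + y ∎

  +-mono-≤ : ∀ {x x′ y y′} → x ≤ x′ → y ≤ y′ → x + y ≤ x′ + y′
  +-mono-≤ {x′ = x′} {y} x≤x′ y≤y′ = ≤-trans (+-monoˡ-≤ y x≤x′) (+-monoʳ-≤ x′ y≤y′)

  +-cancelʳ-≤ : ∀ z {x y} → x + z ≤ y + z → x ≤ y
  +-cancelʳ-≤ z {x} {y} x+z≤y+z = begin
    x           ≈⟨ //-rightDividesʳ z x ⟨
    (x + z) - z ≤⟨ +-monoˡ-≤ (- z) x+z≤y+z ⟩
    (y + z) - z ≈⟨ //-rightDividesʳ z y ⟩
    y           ∎

  x≤y⇒0≤y-x : ∀ {x y} → x ≤ y → 0# ≤ y - x
  x≤y⇒0≤y-x {x} {y} x≤y = begin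
    0#    ≈⟨ -‿inverseʳ x ⟨
    x - x ≤⟨ +-monoˡ-≤ (- x) x≤y ⟩
    y - x ∎

  x≤y⇒x-y≤0 : ∀ {x y} → x ≤ y → x - y ≤ 0#
  x≤y⇒x-y≤0 {x} {y} x≤y = begin
    x - y ≤⟨ +-monoˡ-≤ (- y) x≤y ⟩
    y - y ≈⟨ -‿inverseʳ y ⟩
    0#    ∎

  0≤y-x⇒x≤y : ∀ {x y} → 0# ≤ y - x → x ≤ y
  0≤y-x⇒x≤y {x} {y} 0≤y-x = begin
    x           ≈⟨ +-identityˡ x ⟨
    0# + x      ≤⟨ +-monoˡ-≤ x 0≤y-x ⟩
    (y - x) + x ≈⟨ //-rightDividesˡ x y ⟩
    y           ∎

  *-monoʳ-≤ : ∀ {x y} z → 0# ≤ z → x ≤ y → x * z ≤ y * z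
  *-monoʳ-≤ {x} {y} z 0≤z x≤y = 0≤y-x⇒x≤y (begin
    0#                ≤⟨ *-nonneg (x≤y⇒0≤y-x x≤y) 0≤z ⟩
    (y - x) * z       ≈⟨ distribʳ z y (- x) ⟩
    y * z + - x * z   ≈⟨ +-congˡ (-‿distribˡ-* x z) ⟨
    y * z - x * z     ∎)

  0≤1 : 0# ≤ 1#
  0≤1 with total 0# 1#
  ... | inj₁ 0≤1 = 0≤1
  ... | inj₂ 1≤0 = begin
    0#            ≤⟨ *-nonneg 0≤-1 0≤-1 ⟩
    - 1# * - 1#   ≈⟨ -1*x≈-x (- 1#) ⟩
    - - 1#        ≈⟨ -‿involutive 1# ⟩
    1#            ∎
    where
    0≤-1 : 0# ≤ - 1#
    0≤-1 = ≤-trans (x≤y⇒0≤y-x 1≤0) (≤-reflexive (+-identityˡ (- 1#)))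

  width : Carrier → Carrier → Carrier
  width u w = 0# ⊔ (w - u)

  width-nonneg : ∀ u w → 0# ≤ width u w
  width-nonneg u w = x≤x⊔y 0# (w - u)

  width-cong : ∀ {u u′ w w′} → u ≈ u′ → w ≈ w′ → width u w ≈ width u′ w′
  width-cong u≈u′ w≈w′ = ⊔-congˡ 0# (+-cong w≈w′ (-‿cong u≈u′))

  width-empty : ∀ {u w} → w ≤ u → width u w ≈ 0#
  width-empty w≤u = x≤y⇒y⊔x≈y (x≤y⇒x-y≤0 w≤u)

  width-≤ : ∀ {u w} → u ≤ w → width u w ≈ w - u
  width-≤ u≤w = x≤y⇒x⊔y≈y (x≤y⇒0≤y-x u≤w)

  width-+ : ∀ {x z} → 0# ≤ z → width x (x + z) ≈ z
  width-+ {x} {z} 0≤z = begin-equality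
    width x (x + z) ≈⟨ width-≤ (≤-trans (≤-reflexive (sym (+-identityʳ x))) (+-monoʳ-≤ x 0≤z)) ⟩
    (x + z) - x     ≈⟨ +-congʳ (+-comm x z) ⟩
    (z + x) - x     ≈⟨ //-rightDividesʳ x z ⟩
    z               ∎

  width-split : ∀ u b w → width u (w ⊓ b) + width (u ⊔ b) w ≈ width u w
  width-split u b w = by-cases (total b u) (total w b)
    where
    by-cases : b ≤ u ⊎ u ≤ b → w ≤ b ⊎ b ≤ w → width u (w ⊓ b) + width (u ⊔ b) w ≈ width u w
    by-cases (inj₁ b≤u) _ = begin-equality
      width u (w ⊓ b) + width (u ⊔ b) w
        ≈⟨ +-cong (width-empty (≤-trans (x⊓y≤y w b) b≤u)) (width-cong (x≤y⇒y⊔x≈y b≤u) refl) ⟩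
      0# + width u w                    ≈⟨ +-identityˡ _ ⟩
      width u w                         ∎
    by-cases (inj₂ u≤b) (inj₁ w≤b) = begin-equality
      width u (w ⊓ b) + width (u ⊔ b) w
        ≈⟨ +-cong (width-cong refl (x≤y⇒x⊓y≈x w≤b)) (width-empty (≤-trans w≤b (x≤y⊔x u b))) ⟩
      width u w + 0#                    ≈⟨ +-identityʳ _ ⟩
      width u w                         ∎
    by-cases (inj₂ u≤b) (inj₂ b≤w) = begin-equality
      width u (w ⊓ b) + width (u ⊔ b) w
        ≈⟨ +-cong (width-cong refl (x≤y⇒y⊓x≈x b≤w)) (width-cong (x≤y⇒x⊔y≈y u≤b) refl) ⟩
      width u b + width b w             ≈⟨ +-cong (width-≤ u≤b) (width-≤ b≤w) ⟩
      (b - u) + (w - b)                 ≈⟨ +-comm (b - u) (w - b) ⟩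
      (w - b) + (b - u)                 ≈⟨ +-assoc (w - b) b (- u) ⟨
      ((w - b) + b) - u                 ≈⟨ +-congʳ (//-rightDividesˡ b w) ⟩
      w - u                             ≈⟨ width-≤ (≤-trans u≤b b≤w) ⟨
      width u w                         ∎

module Expectation {c ℓ₁ ℓ₂} (F : OrderedField c ℓ₁ ℓ₂) where
  open OrderedFieldProperties F
  open import Data.Nat.ListAction using (sum)
  import Data.Nat.Properties as ℕₚ
  open import Relation.Nullary using (yes; no)
  open import Relation.Binary.Reasoning.PartialOrder poset

  open ListSum +-commutativeMonoid public

  ∑-mono-≤ : ∀ {a} {A : Set a} (xs : List A) {f g : A → Carrier} → (∀ x → f x ≤ g x) → ∑ xs f ≤ ∑ xs g
  ∑-mono-≤ = ∑-mono {_≤_ = _≤_} ≤-refl +-mono-≤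

  ∑-*ʳ : ∀ {a} {A : Set a} (xs : List A) (f : A → Carrier) c → ∑[ x ← xs ] (f x * c) ≈ ∑ xs f * c
  ∑-*ʳ []       f c = sym (zeroˡ c)
  ∑-*ʳ (x ∷ xs) f c = trans (+-congˡ (∑-*ʳ xs f c)) (sym (distribʳ c (f x) (∑ xs f)))

  ⟦_⟧ : ℕ → Carrier
  ⟦ k ⟧ = ℕ→F F k

  ⟦⟧-cong : ∀ {j k} → j ≡ k → ⟦ j ⟧ ≈ ⟦ k ⟧
  ⟦⟧-cong j≡k = reflexive (≡.cong ⟦_⟧ j≡k)

  ⟦1⟧*x≈x : ∀ x → ⟦ 1 ⟧ * x ≈ x
  ⟦1⟧*x≈x x = trans (*-congʳ (+-identityʳ 1#)) (*-identityˡ x)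

  ⟦⟧-nonneg : ∀ k → 0# ≤ ⟦ k ⟧
  ⟦⟧-nonneg zero    = ≤-refl
  ⟦⟧-nonneg (suc k) = ≤-trans (≤-reflexive (sym (+-identityˡ 0#))) (+-mono-≤ 0≤1 (⟦⟧-nonneg k))

  ⟦⟧-+ : ∀ j k → ⟦ j ℕ.+ k ⟧ ≈ ⟦ j ⟧ + ⟦ k ⟧
  ⟦⟧-+ zero    k = sym (+-identityˡ ⟦ k ⟧)
  ⟦⟧-+ (suc j) k = trans (+-congˡ (⟦⟧-+ j k)) (sym (+-assoc 1# ⟦ j ⟧ ⟦ k ⟧))

  ⟦⟧-mono : ∀ {j k} → j ℕ.≤ k → ⟦ j ⟧ ≤ ⟦ k ⟧
  ⟦⟧-mono {j} j≤k with ℕₚ.m≤n⇒∃[o]m+o≡n j≤k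
  ... | o , ≡.refl = begin
    ⟦ j ⟧          ≈⟨ +-identityʳ ⟦ j ⟧ ⟨
    ⟦ j ⟧ + 0#     ≤⟨ +-monoʳ-≤ ⟦ j ⟧ (⟦⟧-nonneg o) ⟩
    ⟦ j ⟧ + ⟦ o ⟧  ≈⟨ ⟦⟧-+ j o ⟨
    ⟦ j ℕ.+ o ⟧    ∎

  ⟦⟧-∑ : ∀ {a} {A : Set a} (xs : List A) (f : A → ℕ) → ⟦ sum (map f xs) ⟧ ≈ ∑[ x ← xs ] ⟦ f x ⟧
  ⟦⟧-∑ []       f = refl
  ⟦⟧-∑ (x ∷ xs) f = trans (⟦⟧-+ (f x) (sum (map f xs))) (+-congˡ (⟦⟧-∑ xs f))

  expect : ∀ {a} {A : Set a} → List A → (A → Carrier) → (A → ℕ) → Carrier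
  expect xs K f = ∑[ x ← xs ] (⟦ f x ⟧ * K x)

  module _ {a} {A : Set a} (xs : List A) (K : A → Carrier) where

    expect-+ : ∀ f g → expect xs K (λ x → f x ℕ.+ g x) ≈ expect xs K f + expect xs K g
    expect-+ f g = trans
      (∑-cong xs (λ x → trans (*-congʳ (⟦⟧-+ (f x) (g x))) (distribʳ (K x) ⟦ f x ⟧ ⟦ g x ⟧)))
      (∑-distrib xs (λ x → ⟦ f x ⟧ * K x) (λ x → ⟦ g x ⟧ * K x))

    expect-mono : (∀ x → 0# ≤ K x) → ∀ {f g} → (∀ x → f x ℕ.≤ g x) → expect xs K f ≤ expect xs K g
    expect-mono K≥0 f≤g = ∑-mono-≤ xs (λ x → *-monoʳ-≤ (K x) (K≥0 x) (⟦⟧-mono (f≤g x)))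

    expect-∑ : ∀ {b} {B : Set b} (ys : List B) (f : B → A → ℕ) →
               expect xs K (λ x → sum (map (λ y → f y x) ys)) ≈ ∑[ y ← ys ] expect xs K (f y)
    expect-∑ ys f = trans
      (∑-cong xs (λ x → trans (*-congʳ (⟦⟧-∑ ys (λ y → f y x))) (sym (∑-*ʳ ys (λ y → ⟦ f y x ⟧) (K x)))))
      (∑-swap xs ys (λ x y → ⟦ f y x ⟧ * K x))

    expect-cong-on-support : ∀ {f g} → (∀ x → K x ≈ 0# ⊎ f x ≡ g x) → expect xs K f ≈ expect xs K g
    expect-cong-on-support {f} {g} agree = ∑-cong xs pointwise
      where
      pointwise : ∀ x → ⟦ f x ⟧ * K x ≈ ⟦ g x ⟧ * K x
      pointwise x with agree x
      ... | inj₁ Kx≈0  = trans (*-congˡ Kx≈0) (trans (zeroʳ ⟦ f x ⟧) (sym (trans (*-congˡ Kx≈0) (zeroʳ ⟦ g x ⟧))))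
      ... | inj₂ fx≡gx = *-congʳ (⟦⟧-cong fx≡gx)

  expect-fiber : ∀ {a} {A : Set a} {n} (xs : List A) K (key : A → Fin n) (f : Fin n → ℕ) →
    expect xs K (λ x → f (key x)) ≈ ∑[ k ← allFin n ] (⟦ f k ⟧ * ∑ (filter (λ x → key x Fin.≟ k) xs) K)
  expect-fiber {n = n} []       K key f = sym (∑-zero (allFin n) (λ k → zeroʳ ⟦ f k ⟧))
  expect-fiber {n = n} (x ∷ xs) K key f = begin-equality
    ⟦ f (key x) ⟧ * K x + expect xs K (λ x → f (key x))
      ≈⟨ +-cong (sym (∑-when-≡ (key x) (λ k → ⟦ f k ⟧ * K x))) (expect-fiber xs K key f) ⟩
    ∑[ k ← allFin n ] when (key x Fin.≟ k) (⟦ f k ⟧ * K x) + ∑[ k ← allFin n ] (⟦ f k ⟧ * fiber xs k)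
      ≈⟨ ∑-distrib (allFin n) _ _ ⟨
    ∑[ k ← allFin n ] (when (key x Fin.≟ k) (⟦ f k ⟧ * K x) + ⟦ f k ⟧ * fiber xs k)
      ≈⟨ ∑-cong (allFin n) add-x ⟩
    ∑[ k ← allFin n ] (⟦ f k ⟧ * fiber (x ∷ xs) k) ∎
    where
    fiber : List _ → Fin n → Carrier
    fiber ys k = ∑ (filter (λ y → key y Fin.≟ k) ys) K
    add-x : ∀ k → when (key x Fin.≟ k) (⟦ f k ⟧ * K x) + ⟦ f k ⟧ * fiber xs k ≈ ⟦ f k ⟧ * fiber (x ∷ xs) k
    add-x k with key x Fin.≟ k
    ... | yes _ = sym (distribˡ ⟦ f k ⟧ (K x) (fiber xs k))
    ... | no  _ = +-identityˡ (⟦ f k ⟧ * fiber xs k)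

module MonotoneCells {c ℓ₁ ℓ₂} (F : OrderedField c ℓ₁ ℓ₂) (n : ℕ) where
  open OrderedFieldProperties F
  open Expectation F
  open import Data.Nat using (_≤′_; ≤′-refl; ≤′-step)
  open import Data.Nat.Properties using (≤⇒≤′)
  import Data.Nat.Properties as ℕₚ
  import Data.Fin.Properties as Finₚ
  open import Data.Vec.Functional using (tail)
  open import Relation.Nullary using (¬_; yes; no)
  open import Relation.Binary.Definitions using (tri<; tri≈; tri>)
  open import Relation.Binary.Reasoning.PartialOrder poset
  open import Algebra.Properties.CommutativeSemigroup ⊔-commutativeSemigroup using () renaming (xy∙z≈xz∙y to ⊔-swapʳ)
  open import Algebra.Properties.CommutativeSemigroup ⊓-commutativeSemigroup using () renaming (xy∙z≈xz∙y to ⊓-swapʳ)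

  Monotone : (ℕ → Carrier) → Set ℓ₂
  Monotone b = ∀ s → b s ≤ b (suc s)

  monotone-≤ : ∀ {b} → Monotone b → ∀ {s s′} → s ℕ.≤ s′ → b s ≤ b s′
  monotone-≤ {b} b↑ s≤s′ = go (≤⇒≤′ s≤s′)
    where
    go : ∀ {s s′} → s ≤′ s′ → b s ≤ b s′
    go ≤′-refl       = ≤-refl
    go (≤′-step s≤′) = ≤-trans (go s≤′) (b↑ _)

  -- [cellLow G m x, cellHigh G m y] = [x, y] ∩ ⋂ᵢ [Gᵢ(mᵢ), Gᵢ(mᵢ + 1)]
  cellLow : ∀ {d} → (Fin d → ℕ → Carrier) → Tuple d n → Carrier → Carrier
  cellLow {zero}  G m x = x
  cellLow {suc d} G m x = cellLow (tail G) (tail m) (x ⊔ G Fin.zero (toℕ (m Fin.zero)))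

  cellHigh : ∀ {d} → (Fin d → ℕ → Carrier) → Tuple d n → Carrier → Carrier
  cellHigh {zero}  G m y = y
  cellHigh {suc d} G m y = cellHigh (tail G) (tail m) (y ⊓ G Fin.zero (suc (toℕ (m Fin.zero))))

  cellWidth : ∀ {d} → (Fin d → ℕ → Carrier) → Tuple d n → Carrier → Carrier → Carrier
  cellWidth G m x y = width (cellLow G m x) (cellHigh G m y)

  cellLow-cong : ∀ {d} (G : Fin d → ℕ → Carrier) m {x x′} → x ≈ x′ → cellLow G m x ≈ cellLow G m x′
  cellLow-cong {zero}  G m x≈x′ = x≈x′
  cellLow-cong {suc d} G m x≈x′ = cellLow-cong (tail G) (tail m) (⊔-congʳ _ x≈x′)

  cellHigh-cong : ∀ {d} (G : Fin d → ℕ → Carrier) m {y y′} → y ≈ y′ → cellHigh G m y ≈ cellHigh G m y′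
  cellHigh-cong {zero}  G m y≈y′ = y≈y′
  cellHigh-cong {suc d} G m y≈y′ = cellHigh-cong (tail G) (tail m) (⊓-congʳ _ y≈y′)

  cellWidth-cong : ∀ {d} (G : Fin d → ℕ → Carrier) m {x x′ y y′} → x ≈ x′ → y ≈ y′ →
                   cellWidth G m x y ≈ cellWidth G m x′ y′
  cellWidth-cong G m x≈x′ y≈y′ = width-cong (cellLow-cong G m x≈x′) (cellHigh-cong G m y≈y′)

  x≤cellLow : ∀ {d} (G : Fin d → ℕ → Carrier) m x → x ≤ cellLow G m x
  x≤cellLow {zero}  G m x = ≤-refl
  x≤cellLow {suc d} G m x = ≤-trans (x≤x⊔y x _) (x≤cellLow (tail G) (tail m) _)

  cellHigh≤y : ∀ {d} (G : Fin d → ℕ → Carrier) m y → cellHigh G m y ≤ y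
  cellHigh≤y {zero}  G m y = ≤-refl
  cellHigh≤y {suc d} G m y = ≤-trans (cellHigh≤y (tail G) (tail m) _) (x⊓y≤x y _)

  G≤cellLow : ∀ {d} (G : Fin d → ℕ → Carrier) m x i → G i (toℕ (m i)) ≤ cellLow G m x
  G≤cellLow {suc d} G m x Fin.zero    = ≤-trans (x≤y⊔x x _) (x≤cellLow (tail G) (tail m) _)
  G≤cellLow {suc d} G m x (Fin.suc i) = G≤cellLow (tail G) (tail m) _ i

  cellHigh≤G : ∀ {d} (G : Fin d → ℕ → Carrier) m y i → cellHigh G m y ≤ G i (suc (toℕ (m i)))
  cellHigh≤G {suc d} G m y Fin.zero    = ≤-trans (cellHigh≤y (tail G) (tail m) _) (x⊓y≤y y _)
  cellHigh≤G {suc d} G m y (Fin.suc i) = cellHigh≤G (tail G) (tail m) _ i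

  ∑-width-telescope : ∀ x y N (b : ℕ → Carrier) → Monotone b →
    ∑[ k ← allFin N ] width (x ⊔ b (toℕ k)) (y ⊓ b (suc (toℕ k))) ≈ width (x ⊔ b 0) (y ⊓ b N)
  ∑-width-telescope x y zero    b b↑ = sym (width-empty (≤-trans (x⊓y≤y y (b 0)) (x≤y⊔x x (b 0))))
  ∑-width-telescope x y (suc N) b b↑ = begin-equality
    ∑[ k ← allFin (suc N) ] width (x ⊔ b (toℕ k)) (y ⊓ b (suc (toℕ k)))
      ≈⟨ ∑-allFin-suc {N} (λ k → width (x ⊔ b (toℕ k)) (y ⊓ b (suc (toℕ k)))) ⟩
    width (x ⊔ b 0) (y ⊓ b 1) + ∑[ k ← allFin N ] width (x ⊔ b (suc (toℕ k))) (y ⊓ b (suc (suc (toℕ k))))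
      ≈⟨ +-congˡ (∑-width-telescope x y N (λ s → b (suc s)) (λ s → b↑ (suc s))) ⟩
    width (x ⊔ b 0) (y ⊓ b 1) + width (x ⊔ b 1) (y ⊓ b (suc N))
      ≈⟨ +-cong (width-cong refl y⊓b₁≈) (width-cong x⊔b₁≈ refl) ⟩
    width (x ⊔ b 0) ((y ⊓ b (suc N)) ⊓ b 1) + width ((x ⊔ b 0) ⊔ b 1) (y ⊓ b (suc N))
      ≈⟨ width-split (x ⊔ b 0) (b 1) (y ⊓ b (suc N)) ⟩
    width (x ⊔ b 0) (y ⊓ b (suc N)) ∎
    where
    y⊓b₁≈ : y ⊓ b 1 ≈ (y ⊓ b (suc N)) ⊓ b 1
    y⊓b₁≈ = trans (⊓-congˡ y (sym (x≤y⇒y⊓x≈x (monotone-≤ b↑ (ℕ.s≤s ℕ.z≤n)))))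
                  (sym (⊓-assoc y (b (suc N)) (b 1)))
    x⊔b₁≈ : x ⊔ b 1 ≈ (x ⊔ b 0) ⊔ b 1
    x⊔b₁≈ = trans (⊔-congˡ x (sym (x≤y⇒x⊔y≈y (b↑ 0)))) (sym (⊔-assoc x (b 0) (b 1)))

  ∑-cellWidth : ∀ d (G : Fin d → ℕ → Carrier) → (∀ i → Monotone (G i)) → ∀ x y →
    (∀ i → G i 0 ≤ x) → (∀ i → y ≤ G i n) → ∑[ m ← allTuples d n ] cellWidth G m x y ≈ width x y
  ∑-cellWidth zero    G G↑ x y G₀≤x y≤Gₙ = +-identityʳ (width x y)
  ∑-cellWidth (suc d) G G↑ x y G₀≤x y≤Gₙ = begin-equality
    ∑[ m ← allTuples (suc d) n ] cellWidth G m x y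
      ≈⟨ ∑-concatMap (allFin n) (λ k → map (consT k) (allTuples d n)) (λ m → cellWidth G m x y) ⟩
    ∑[ k ← allFin n ] ∑ (map (consT k) (allTuples d n)) (λ m → cellWidth G m x y)
      ≈⟨ ∑-cong (allFin n) (λ k → ∑-map (allTuples d n) (consT k) (λ m → cellWidth G m x y)) ⟩
    ∑[ k ← allFin n ] ∑[ m ← allTuples d n ] cellWidth (tail G) m (x ⊔ G₀ (toℕ k)) (y ⊓ G₀ (suc (toℕ k)))
      ≈⟨ ∑-cong (allFin n) (λ k → ∑-cellWidth d (tail G) (λ i → G↑ (Fin.suc i)) _ _
           (λ i → ≤-trans (G₀≤x (Fin.suc i)) (x≤x⊔y x _)) (λ i → ≤-trans (x⊓y≤x y _) (y≤Gₙ (Fin.suc i)))) ⟩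
    ∑[ k ← allFin n ] width (x ⊔ G₀ (toℕ k)) (y ⊓ G₀ (suc (toℕ k)))
      ≈⟨ ∑-width-telescope x y n G₀ (G↑ Fin.zero) ⟩
    width (x ⊔ G₀ 0) (y ⊓ G₀ n)
      ≈⟨ width-cong (x≤y⇒y⊔x≈y (G₀≤x Fin.zero)) (x≤y⇒x⊓y≈x (y≤Gₙ Fin.zero)) ⟩
    width x y ∎
    where
    G₀ : ℕ → Carrier
    G₀ = G Fin.zero

  cellWidth-fiber : ∀ {d} (G : Fin d → ℕ → Carrier) → (∀ i → Monotone (G i)) → ∀ m i k x y →
    when (m i Fin.≟ k) (cellWidth G m x y) ≈ cellWidth G m (x ⊔ G i (toℕ k)) (y ⊓ G i (suc (toℕ k)))
  cellWidth-fiber {suc d} G G↑ m Fin.zero k x y with m Fin.zero Fin.≟ k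
  ... | yes ≡.refl = cellWidth-cong (tail G) (tail m)
          (sym (trans (⊔-assoc x _ _) (⊔-congˡ x (⊔-idem _)))) (sym (trans (⊓-assoc y _ _) (⊓-congˡ y (⊓-idem _))))
  ... | no m₀≢k with ℕₚ.<-cmp (toℕ (m Fin.zero)) (toℕ k)
  ...   | tri< m₀<k _ _ = sym (width-empty (begin
          cellHigh G m _                  ≤⟨ cellHigh≤G G m _ Fin.zero ⟩
          G Fin.zero (suc (toℕ (m Fin.zero))) ≤⟨ monotone-≤ (G↑ Fin.zero) m₀<k ⟩
          G Fin.zero (toℕ k)              ≤⟨ x≤y⊔x x _ ⟩
          x ⊔ G Fin.zero (toℕ k)          ≤⟨ x≤cellLow G m _ ⟩
          cellLow G m _                   ∎))
  ...   | tri≈ _ m₀≡k _ = ⊥-elim (m₀≢k (Finₚ.toℕ-injective m₀≡k))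
  ...   | tri> _ _ k<m₀ = sym (width-empty (begin
          cellHigh G m _                  ≤⟨ cellHigh≤y G m _ ⟩
          y ⊓ G Fin.zero (suc (toℕ k))    ≤⟨ x⊓y≤y y _ ⟩
          G Fin.zero (suc (toℕ k))        ≤⟨ monotone-≤ (G↑ Fin.zero) k<m₀ ⟩
          G Fin.zero (toℕ (m Fin.zero))   ≤⟨ G≤cellLow G m _ Fin.zero ⟩
          cellLow G m _                   ∎))
  cellWidth-fiber {suc d} G G↑ m (Fin.suc i) k x y = begin-equality
    when (m (Fin.suc i) Fin.≟ k) (cellWidth (tail G) (tail m) (x ⊔ G₀ m₀) (y ⊓ G₀ (suc m₀)))
      ≈⟨ cellWidth-fiber (tail G) (λ i → G↑ (Fin.suc i)) (tail m) i k _ _ ⟩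
    cellWidth (tail G) (tail m) ((x ⊔ G₀ m₀) ⊔ Gᵢ (toℕ k)) ((y ⊓ G₀ (suc m₀)) ⊓ Gᵢ (suc (toℕ k)))
      ≈⟨ cellWidth-cong (tail G) (tail m) (⊔-swapʳ x _ _) (⊓-swapʳ y _ _) ⟩
    cellWidth (tail G) (tail m) ((x ⊔ Gᵢ (toℕ k)) ⊔ G₀ m₀) ((y ⊓ Gᵢ (suc (toℕ k))) ⊓ G₀ (suc m₀)) ∎
    where
    G₀ Gᵢ : ℕ → Carrier
    G₀ = G Fin.zero
    Gᵢ = G (Fin.suc i)
    m₀ : ℕ
    m₀ = toℕ (m Fin.zero)

  cellHigh≤cellLow : ∀ {d} (G : Fin d → ℕ → Carrier) → (∀ i → Monotone (G i)) → ∀ {m m′ x y} a b {s} →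
    toℕ (m a) ℕ.< s → s ℕ.≤ toℕ (m′ b) → G a s ≤ G b s → cellHigh G m y ≤ cellLow G m′ x
  cellHigh≤cellLow G G↑ {m} {m′} {x} {y} a b {s} mₐ<s s≤m′_b Gₐ≤G_b = begin
    cellHigh G m y               ≤⟨ cellHigh≤G G m y a ⟩
    G a (suc (toℕ (m a)))        ≤⟨ monotone-≤ (G↑ a) mₐ<s ⟩
    G a s                        ≤⟨ Gₐ≤G_b ⟩
    G b s                        ≤⟨ monotone-≤ (G↑ b) s≤m′_b ⟩
    G b (toℕ (m′ b))             ≤⟨ G≤cellLow G m′ x b ⟩
    cellLow G m′ x               ∎

  cellWidth-chain : ∀ {d} (G : Fin d → ℕ → Carrier) → (∀ i → Monotone (G i)) → ∀ x y {m m′} →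
    ¬ cellWidth G m x y ≈ 0# → ¬ cellWidth G m′ x y ≈ 0# → m ≤ₜ m′ ⊎ m′ ≤ₜ m
  cellWidth-chain {d} G G↑ x y {m} {m′} m≉0 m′≉0 with Finₚ.all? (λ i → m i Finₚ.≤? m′ i)
  ... | yes m≤m′ = inj₁ m≤m′
  ... | no  m≰m′ with Finₚ.all? (λ i → m′ i Finₚ.≤? m i)
  ...   | yes m′≤m = inj₂ m′≤m
  ...   | no  m′≰m with Finₚ.¬∀⟶∃¬ d _ (λ i → m i Finₚ.≤? m′ i) m≰m′
                        | Finₚ.¬∀⟶∃¬ d _ (λ i → m′ i Finₚ.≤? m i) m′≰m
  ...     | i , mᵢ≰m′ᵢ | j , m′ⱼ≰mⱼ = ⊥-elim (incomparable (total (cellLow G m x) (cellLow G m′ x)))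
    where
    high≤low′ : cellHigh G m y ≤ cellLow G m′ x
    high≤low′ = cellHigh≤cellLow G G↑ j j (ℕₚ.≰⇒> m′ⱼ≰mⱼ) ℕₚ.≤-refl ≤-refl
    high′≤low : cellHigh G m′ y ≤ cellLow G m x
    high′≤low = cellHigh≤cellLow G G↑ i i (ℕₚ.≰⇒> mᵢ≰m′ᵢ) ℕₚ.≤-refl ≤-refl
    incomparable : cellLow G m x ≤ cellLow G m′ x ⊎ cellLow G m′ x ≤ cellLow G m x → ⊥
    incomparable (inj₁ low≤low′) = m′≉0 (width-empty (≤-trans high′≤low low≤low′))
    incomparable (inj₂ low′≤low) = m≉0 (width-empty (≤-trans high≤low′ low′≤low))

module Comonotone {c ℓ₁ ℓ₂} (F : OrderedField c ℓ₁ ℓ₂) {d n : ℕ}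
                  (μ : Fin d → Fin n → OrderedField.Carrier F) (μ-prob : ∀ i → IsProbDist F (μ i)) where
  open OrderedFieldProperties F
  open Expectation F
  open MonotoneCells F n
  open StepFunction using (step; <⇒step≡1; ≥⇒step≡0; step-monoʳ-≤; step-suc-≢)
  import Data.Nat.Properties as ℕₚ
  import Data.Fin.Properties as Finₚ
  open import Relation.Nullary using (yes; no)
  open import Relation.Binary.Reasoning.PartialOrder poset

  -- cdf ν s = ν 0 + ⋯ + ν (s − 1)
  cdf : (Fin n → Carrier) → ℕ → Carrier
  cdf ν s = expect (allFin n) ν (λ k → step (toℕ k) s)

  cdf-0 : ∀ ν → cdf ν 0 ≈ 0#
  cdf-0 ν = ∑-zero (allFin n) (λ k → zeroˡ (ν k))

  cdf-n : ∀ {ν} → IsProbDist F ν → cdf ν n ≈ 1#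
  cdf-n {ν} (_ , ∑ν≈1) = trans (∑-cong (allFin n) one) ∑ν≈1
    where
    one : ∀ k → ⟦ step (toℕ k) n ⟧ * ν k ≈ ν k
    one k = trans (*-congʳ (⟦⟧-cong (<⇒step≡1 (Finₚ.toℕ<n k)))) (⟦1⟧*x≈x (ν k))

  cdf-monotone : ∀ {ν} → (∀ k → 0# ≤ ν k) → Monotone (cdf ν)
  cdf-monotone {ν} ν≥0 s = expect-mono (allFin n) ν ν≥0 (λ k → step-monoʳ-≤ (toℕ k) (ℕₚ.n≤1+n s))

  cdf-suc : ∀ ν k → cdf ν (suc (toℕ k)) ≈ cdf ν (toℕ k) + ν k
  cdf-suc ν k = begin-equality
    cdf ν (suc (toℕ k))
      ≈⟨ ∑-cong (allFin n) split ⟩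
    ∑[ k′ ← allFin n ] (⟦ step (toℕ k′) (toℕ k) ⟧ * ν k′ + when (k Fin.≟ k′) (ν k′))
      ≈⟨ ∑-distrib (allFin n) _ _ ⟩
    cdf ν (toℕ k) + ∑[ k′ ← allFin n ] when (k Fin.≟ k′) (ν k′)
      ≈⟨ +-congˡ (∑-when-≡ k ν) ⟩
    cdf ν (toℕ k) + ν k ∎
    where
    split : ∀ k′ → ⟦ step (toℕ k′) (suc (toℕ k)) ⟧ * ν k′
                   ≈ ⟦ step (toℕ k′) (toℕ k) ⟧ * ν k′ + when (k Fin.≟ k′) (ν k′)
    split k′ with k Fin.≟ k′
    ... | yes ≡.refl = begin-equality
      ⟦ step (toℕ k) (suc (toℕ k)) ⟧ * ν k  ≈⟨ *-congʳ (⟦⟧-cong (<⇒step≡1 (ℕₚ.n<1+n (toℕ k)))) ⟩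
      ⟦ 1 ⟧ * ν k                          ≈⟨ ⟦1⟧*x≈x (ν k) ⟩
      ν k                                  ≈⟨ +-identityˡ (ν k) ⟨
      0# + ν k                             ≈⟨ +-congʳ (zeroˡ (ν k)) ⟨
      0# * ν k + ν k                       ≈⟨ +-congʳ (*-congʳ (⟦⟧-cong (≥⇒step≡0 (ℕₚ.≤-refl {toℕ k})))) ⟨
      ⟦ step (toℕ k) (toℕ k) ⟧ * ν k + ν k ∎
    ... | no k≢k′ = begin-equality
      ⟦ step (toℕ k′) (suc (toℕ k)) ⟧ * ν k′
        ≈⟨ *-congʳ (⟦⟧-cong (step-suc-≢ (λ k′≡k → k≢k′ (Finₚ.toℕ-injective (≡.sym k′≡k))))) ⟩
      ⟦ step (toℕ k′) (toℕ k) ⟧ * ν k′       ≈⟨ +-identityʳ _ ⟨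
      ⟦ step (toℕ k′) (toℕ k) ⟧ * ν k′ + 0#  ∎

  cdfs : Fin d → ℕ → Carrier
  cdfs i = cdf (μ i)

  cdfs-monotone : ∀ i → Monotone (cdfs i)
  cdfs-monotone i = cdf-monotone (proj₁ (μ-prob i))

  comonotone : Tuple d n → Carrier
  comonotone m = cellWidth cdfs m 0# 1#

  comonotone-marginal : ∀ i k → ∑ (filter (λ m → m i Fin.≟ k) (allTuples d n)) comonotone ≈ μ i k
  comonotone-marginal i k = begin-equality
    ∑ (filter (λ m → m i Fin.≟ k) (allTuples d n)) comonotone
      ≈⟨ ∑-filter (λ m → m i Fin.≟ k) (allTuples d n) comonotone ⟩
    ∑[ m ← allTuples d n ] when (m i Fin.≟ k) (comonotone m)
      ≈⟨ ∑-cong (allTuples d n) (λ m → cellWidth-fiber cdfs cdfs-monotone m i k 0# 1#) ⟩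
    ∑[ m ← allTuples d n ] cellWidth cdfs m (0# ⊔ Fₖ) (1# ⊓ Fₖ₊₁)
      ≈⟨ ∑-cellWidth d cdfs cdfs-monotone _ _ (λ j → ≤-trans (≤-reflexive (cdf-0 (μ j))) (x≤x⊔y 0# Fₖ))
                                             (λ j → ≤-trans (x⊓y≤x 1# Fₖ₊₁) (≤-reflexive (sym (cdf-n (μ-prob j))))) ⟩
    width (0# ⊔ Fₖ) (1# ⊓ Fₖ₊₁)
      ≈⟨ width-cong (x≤y⇒x⊔y≈y 0≤Fₖ) (x≤y⇒y⊓x≈x Fₖ₊₁≤1) ⟩
    width Fₖ Fₖ₊₁
      ≈⟨ width-cong refl (cdf-suc (μ i) k) ⟩
    width Fₖ (Fₖ + μ i k)
      ≈⟨ width-+ (proj₁ (μ-prob i) k) ⟩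
    μ i k ∎
    where
    Fₖ Fₖ₊₁ : Carrier
    Fₖ   = cdfs i (toℕ k)
    Fₖ₊₁ = cdfs i (suc (toℕ k))
    0≤Fₖ : 0# ≤ Fₖ
    0≤Fₖ = ≤-trans (≤-reflexive (sym (cdf-0 (μ i)))) (monotone-≤ (cdfs-monotone i) (ℕ.z≤n {toℕ k}))
    Fₖ₊₁≤1 : Fₖ₊₁ ≤ 1#
    Fₖ₊₁≤1 = ≤-trans (monotone-≤ (cdfs-monotone i) (Finₚ.toℕ<n k)) (≤-reflexive (cdf-n (μ-prob i)))

  comonotone-isCoupling : IsCoupling F μ comonotone
  comonotone-isCoupling = (λ m → width-nonneg _ _) , comonotone-marginal

  comonotone-chain : SupportIsChain F comonotone
  comonotone-chain m m′ = cellWidth-chain cdfs cdfs-monotone 0# 1#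

  comonotone-inversion : ∀ m a b {s} → toℕ (m a) ℕ.< s → s ℕ.≤ toℕ (m b) → cdfs a s ≤ cdfs b s →
                         comonotone m ≈ 0#
  comonotone-inversion m a b mₐ<s s≤m_b Fₐ≤F_b =
    width-empty (cellHigh≤cellLow cdfs cdfs-monotone a b mₐ<s s≤m_b Fₐ≤F_b)

module Optimality {c ℓ₁ ℓ₂} (F : OrderedField c ℓ₁ ℓ₂) (d′ n : ℕ)
                  (μ : Fin (suc d′) → Fin n → OrderedField.Carrier F) (μ-prob : ∀ i → IsProbDist F (μ i)) where
  open OrderedFieldProperties F
  open Expectation F
  open Comonotone F μ μ-prob
  open MedianCost d′ n using (d; below; minorityAt; cost≡∑minorityAt)
  open NatSums using (length-allFin)
  open StepFunction using (step; step≤1; step≡1⇒<; step≡0⇒≥)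
  open BinaryLists
  import Data.Nat.Properties as ℕₚ
  open import Data.Nat.ListAction using (sum)
  open import Data.Nat.ListAction.Properties using (sum-↭)
  open import Data.List using (take; drop)
  open import Data.List.Properties using (length-map; take-map; drop-map)
  import Data.List.Relation.Binary.Permutation.Propositional.Properties as ↭
  open import Data.List.Relation.Unary.All using (All; universal)
  open import Data.List.Relation.Unary.All.Properties using () renaming (map⁺ to All-map⁺)
  open import Relation.Binary.Reasoning.PartialOrder poset

  tuples : List (Tuple d n)
  tuples = allTuples d n

  expect-coordinate : ∀ K → IsCoupling F μ K → ∀ j (g : Fin n → ℕ) →
                      expect tuples K (λ m → g (m j)) ≈ expect (allFin n) (μ j) g
  expect-coordinate K (_ , marginal) j g = trans (expect-fiber tuples K (λ m → m j) g)
                                                 (∑-cong (allFin n) (λ k → *-congˡ (marginal j k)))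

  count : ℕ → List (Fin d) → Tuple d n → ℕ
  count s L m = sum (map (λ j → step (toℕ (m j)) s) L)

  expect-count : ∀ K → IsCoupling F μ K → ∀ s L → expect tuples K (count s L) ≈ ∑[ j ← L ] cdfs j s
  expect-count K K-coupling s L = trans (expect-∑ tuples K L (λ j m → step (toℕ (m j)) s))
    (∑-cong L (λ j → expect-coordinate K K-coupling j (λ k → step (toℕ k) s)))

  module Threshold (s : ℕ) where

    _≼_ : Fin d → Fin d → Set ℓ₂
    a ≼ b = cdfs a s ≤ cdfs b s

    ≼-total : ∀ a b → a ≼ b ⊎ b ≼ a
    ≼-total a b = total (cdfs a s) (cdfs b s)

    open InsertionSort _≼_ ≼-total ≤-trans

    σ : List (Fin d)
    σ = sort (allFin d)

    h w : ℕ
    h = proj₁ (halve d)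
    w = proj₁ (proj₂ (halve d))

    top bottom : List (Fin d)
    top    = drop (h ℕ.+ w) σ
    bottom = take h σ

    bits : Tuple d n → List ℕ
    bits m = map (λ j → step (toℕ (m j)) s) σ

    d≡h+[h+w] : d ≡ h ℕ.+ (h ℕ.+ w)
    d≡h+[h+w] = proj₂ (proj₂ (proj₂ (halve d)))

    length-bits : ∀ m → length (bits m) ≡ h ℕ.+ (h ℕ.+ w)
    length-bits m = ≡.trans (length-map _ σ)
      (≡.trans (↭.↭-length (sort-↭ (allFin d))) (≡.trans (length-allFin d) d≡h+[h+w]))

    sum-bits : ∀ m → sum (bits m) ≡ below m s
    sum-bits m = sum-↭ (↭.map⁺ _ (sort-↭ (allFin d)))

    bits-minority+bottom : ∀ m → minority (bits m) ℕ.+ sum (take h (bits m)) ≡ minorityAt m s ℕ.+ count s bottom m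
    bits-minority+bottom m = ≡.trans
      (≡.cong₂ (λ a l → a ℕ.⊓ (l ℕ.∸ a) ℕ.+ sum (take h (bits m)))
               (sum-bits m) (≡.trans (length-bits m) (≡.sym d≡h+[h+w])))
      (≡.cong (λ l → minorityAt m s ℕ.+ sum l) (take-map h σ))

    bits-top : ∀ m → sum (drop (h ℕ.+ w) (bits m)) ≡ count s top m
    bits-top m = ≡.cong sum (drop-map (h ℕ.+ w) σ)

    bits≤1 : ∀ m → All (ℕ._≤ 1) (bits m)
    bits≤1 m = All-map⁺ (universal (λ j → step≤1 (toℕ (m j)) s) σ)

    count-top≤minorityAt+count-bottom : ∀ m → count s top m ℕ.≤ minorityAt m s ℕ.+ count s bottom m
    count-top≤minorityAt+count-bottom m = ℕₚ.≤-trans (ℕₚ.≤-reflexive (≡.sym (bits-top m)))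
      (ℕₚ.≤-trans (sum-drop≤minority+sum-take h w (bits≤1 m) (length-bits m)) (ℕₚ.≤-reflexive (bits-minority+bottom m)))

    count-top-tight : ∀ m → comonotone m ≈ 0# ⊎ minorityAt m s ℕ.+ count s bottom m ≡ count s top m
    count-top-tight m with zerosThenOnes-or-inversion _≼_ (λ j → step (toℕ (m j)) s) (λ j → step≤1 (toℕ (m j)) s)
                                                      σ (sort-sorted (allFin d))
    ... | inj₁ sorted = inj₂ (ℕₚ.≤-antisym minorityAt+count-bottom≤count-top (count-top≤minorityAt+count-bottom m))
      where
      minorityAt+count-bottom≤count-top : minorityAt m s ℕ.+ count s bottom m ℕ.≤ count s top m
      minorityAt+count-bottom≤count-top = ℕₚ.≤-trans (ℕₚ.≤-reflexive (≡.sym (bits-minority+bottom m)))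
        (ℕₚ.≤-trans (minority+sum-take≤sum-drop h w (proj₁ (proj₂ (proj₂ (halve d)))) sorted (length-bits m))
                    (ℕₚ.≤-reflexive (bits-top m)))
    ... | inj₂ (a , b , a≼b , mₐ≤t , t<m_b) =
      inj₁ (comonotone-inversion m a b {s} (step≡1⇒< mₐ≤t) (step≡0⇒≥ t<m_b) a≼b)

    comonotone-optimalAt : ∀ K → IsCoupling F μ K →
      expect tuples comonotone (λ m → minorityAt m s) ≤ expect tuples K (λ m → minorityAt m s)
    comonotone-optimalAt K K-coupling = +-cancelʳ-≤ (∑[ j ← bottom ] cdfs j s) (begin
      expect tuples J minority-s + ∑[ j ← bottom ] cdfs j s
        ≈⟨ +-congˡ (expect-count J comonotone-isCoupling s bottom) ⟨
      expect tuples J minority-s + expect tuples J (count s bottom)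
        ≈⟨ expect-+ tuples J minority-s (count s bottom) ⟨
      expect tuples J (λ m → minorityAt m s ℕ.+ count s bottom m)
        ≈⟨ expect-cong-on-support tuples J count-top-tight ⟩
      expect tuples J (count s top)
        ≈⟨ expect-count J comonotone-isCoupling s top ⟩
      ∑[ j ← top ] cdfs j s
        ≈⟨ expect-count K K-coupling s top ⟨
      expect tuples K (count s top)
        ≤⟨ expect-mono tuples K (proj₁ K-coupling) count-top≤minorityAt+count-bottom ⟩
      expect tuples K (λ m → minorityAt m s ℕ.+ count s bottom m)
        ≈⟨ expect-+ tuples K minority-s (count s bottom) ⟩
      expect tuples K minority-s + expect tuples K (count s bottom)
        ≈⟨ +-congˡ (expect-count K K-coupling s bottom) ⟩
      expect tuples K minority-s + ∑[ j ← bottom ] cdfs j s ∎)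
      where
      J : Tuple d n → Carrier
      J = comonotone
      minority-s : Tuple d n → ℕ
      minority-s m = minorityAt m s

  totalCost≈∑expect-minorityAt : ∀ K →
    totalCost F K ≈ ∑[ t ← allFin n ] expect tuples K (λ m → minorityAt m (suc (toℕ t)))
  totalCost≈∑expect-minorityAt K = trans
    (∑-cong tuples (λ m → *-congʳ (⟦⟧-cong (cost≡∑minorityAt m))))
    (expect-∑ tuples K (allFin n) (λ t m → minorityAt m (suc (toℕ t))))

  comonotone-optimal : ∀ K → IsCoupling F μ K → totalCost F comonotone ≤ totalCost F K
  comonotone-optimal K K-coupling = begin
    totalCost F comonotone
      ≈⟨ totalCost≈∑expect-minorityAt comonotone ⟩
    ∑[ t ← allFin n ] expect tuples comonotone (λ m → minorityAt m (suc (toℕ t)))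
      ≤⟨ ∑-mono-≤ (allFin n) (λ t → Threshold.comonotone-optimalAt (suc (toℕ t)) K K-coupling) ⟩
    ∑[ t ← allFin n ] expect tuples K (λ m → minorityAt m (suc (toℕ t)))
      ≈⟨ totalCost≈∑expect-minorityAt K ⟨
    totalCost F K ∎

open import Data.Nat using (ℕ; _≤_)
open import Data.Fin using (Fin)
open import Data.Product using (Σ; _×_)

corollary3p7 : ∀ {c ℓ₁ ℓ₂} (F : OrderedField c ℓ₁ ℓ₂) (d n : ℕ) → 1 ≤ d → 1 ≤ n →
    (μ : Fin d → Fin n → OrderedField.Carrier F) → (∀ i → IsProbDist F (μ i)) →
    Σ (Tuple d n → OrderedField.Carrier F) (λ J →
      IsCoupling F μ J × SupportIsChain F J ×
      (∀ J' → IsCoupling F μ J' → OrderedField._≤_ F (totalCost F J) (totalCost F J')))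
corollary3p7 F (suc d′) n (ℕ.s≤s ℕ.z≤n) _ μ μ-prob =
  comonotone , comonotone-isCoupling , comonotone-chain , comonotone-optimal
  where
  open Comonotone F μ μ-prob
  open Optimality F d′ n μ μ-prob
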